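{- Let $A$ be a commutative semigroup, $B$ an abelian group, and $f:A\to B$ a polynomial map of some degree $d$. If $a,b,c\in A$ satisfy $a+c=b+c$, then $f(a)=f(b)$.
   Context: A function $f:A\to B$ is a polynomial map of degree $0$ if it is constant; it is polynomial of degree $d+1$ if the function $\phi:A^2\to B$, $\phi(x,z)=f(x+z)-f(x)-f(z)$, is polynomial of degree $d$ (with $A^2$ the product semigroup). -}

module Defs where

open import Level using (Level; suc; _⊔_)
open import Data.Nat using (ℕ; zero) renaming (suc to sucℕ)
open import Data.Product using (_×_; _,_; proj₁; proj₂; Σ)
open import Algebra.Bundles using (AbelianGroup)
open import Algebra.Structures using (IsCommutativeSemigroup; IsSemigroup; IsMagma)
open import Relation.Binary.PropositionalEquality
  using (_≡_; refl; cong₂) renaming (isEquivalence to ≡-isEquivalence)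

-- A commutative semigroup whose equality is propositional equality
-- (the paper's semigroups are plain sets with an operation).
record CommSemigroup (a : Level) : Set (suc a) where
  infixl 7 _∙_
  field
    Carrier : Set a
    _∙_     : Carrier → Carrier → Carrier
    isCommutativeSemigroup : IsCommutativeSemigroup _≡_ _∙_
  open IsCommutativeSemigroup isCommutativeSemigroup public

_² : ∀ {a} → CommSemigroup a → CommSemigroup a
A ² = record
  { Carrier = C × C
  ; _∙_ = λ p q → (proj₁ p ∙ proj₁ q , proj₂ p ∙ proj₂ q)
  ; isCommutativeSemigroup = record
    { isSemigroup = record
      { isMagma = record
        { isEquivalence = ≡-isEquivalence
        ; ∙-cong = λ { refl refl → refl } }
      ; assoc = λ x y z → cong₂ _,_ (assoc (proj₁ x) (proj₁ y) (proj₁ z))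
                                    (assoc (proj₂ x) (proj₂ y) (proj₂ z)) }
    ; comm = λ x y → cong₂ _,_ (comm (proj₁ x) (proj₁ y)) (comm (proj₂ x) (proj₂ y)) }
  }
  where open CommSemigroup A using (assoc; comm; _∙_) renaming (Carrier to C)

IsPolynomial : ∀ {a b ℓ} (B : AbelianGroup b ℓ) → ℕ →
               (A : CommSemigroup a) →
               (CommSemigroup.Carrier A → AbelianGroup.Carrier B) → Set (a ⊔ b ⊔ ℓ)
IsPolynomial B zero A f =
  Σ (AbelianGroup.Carrier B) λ c → ∀ x → AbelianGroup._≈_ B (f x) c
IsPolynomial B (sucℕ d) A f =
  IsPolynomial B d (A ²)
    (λ p → (f (proj₁ p ∙ proj₂ p) - f (proj₁ p)) - f (proj₂ p))
  where
    open CommSemigroup A using (_∙_)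
    open AbelianGroup B using (_-_)

module Submission where

open import Defs
open import Data.Nat using (ℕ; zero; suc)
open import Data.Product using (_,_)
open import Algebra.Bundles using (AbelianGroup)
open import Relation.Binary.PropositionalEquality as ≡ using (_≡_; cong; cong₂)
import Algebra.Properties.Group as GroupProperties

-- Induction on the degree, with the semigroup varying: if x + z = y + z then
-- (x, z) + (z, z) = (y, z) + (z, z) in A², so the degree-d map φ agrees at
-- (x, z) and (y, z); as f (x + z) = f (y + z), the remaining terms give f x = f y.

module _ {b ℓ} (B : AbelianGroup b ℓ) where
  open AbelianGroup B
  open GroupProperties group using (⁻¹-injective; ∙-cancelˡ; ∙-cancelʳ)

  s-u-t≈s-v-t⇒u≈v : ∀ s t {u v} → (s - u) - t ≈ (s - v) - t → u ≈ v
  s-u-t≈s-v-t⇒u≈v s t eq = ⁻¹-injective (∙-cancelˡ s _ _ (∙-cancelʳ (t ⁻¹) _ _ eq))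

lemma3p4 : ∀ {a b ℓ} (A : CommSemigroup a) (B : AbelianGroup b ℓ)
    (f : CommSemigroup.Carrier A → AbelianGroup.Carrier B) (d : ℕ) →
    IsPolynomial B d A f →
    ∀ (x y z : CommSemigroup.Carrier A) →
    CommSemigroup._∙_ A x z ≡ CommSemigroup._∙_ A y z →
    AbelianGroup._≈_ B (f x) (f y)
lemma3p4 A B f zero (c , f≈c) x y z _ = trans (f≈c x) (sym (f≈c y))
  where open AbelianGroup B
lemma3p4 A B f (suc d) φ-polynomial x y z x∙z≡y∙z =
  s-u-t≈s-v-t⇒u≈v B (f (x ∙ z)) (f z) (begin
    f (x ∙ z) - f x - f z  ≈⟨ φ-agrees ⟩
    f (y ∙ z) - f y - f z  ≡⟨ cong (λ w → f w - f y - f z) (≡.sym x∙z≡y∙z) ⟩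
    f (x ∙ z) - f y - f z  ∎)
  where
  open CommSemigroup A using (_∙_)
  open AbelianGroup B using (_-_; _≈_)
  open import Relation.Binary.Reasoning.Setoid (AbelianGroup.setoid B)
  φ-agrees : f (x ∙ z) - f x - f z ≈ f (y ∙ z) - f y - f z
  φ-agrees = lemma3p4 (A ²) B _ d φ-polynomial (x , z) (y , z) (z , z)
                      (cong₂ _,_ x∙z≡y∙z ≡.refl)
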